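{- Let $m\ge 0$ be an integer and $n\in\{24m+8,\ 24m+16\}$. If there is no extremal doubly-even self-dual binary code of length $n$ (i.e. no doubly-even self-dual $[n,n/2,4m+4]$ code), then there is no extremal singly-even self-dual binary code of length $n$ with minimal shadow.
   Context: A binary linear code $C$ of length $n$ is self-dual if $C=C^\perp$; it is doubly-even if all its weights are divisible by $4$, and singly-even if all weights are even but some codeword has weight $\equiv 2 \pmod 4$. For a singly-even self-dual code $C$, let $C_0$ be its doubly-even subcode; then $C_0^\perp=C_0\cup C_1\cup C_2\cup C_3$ for cosets $C_1,C_2,C_3$ of $C_0$ with $C=C_0\cup C_2$, and the shadow of $C$ is $S=C_1\cup C_3=C_0^\perp\setminus C$. Write $\mathrm{wt}(S)$ for the minimum Hamming weight of a vector in $S$. A self-dual code of length $n\not\equiv 22 \pmod{24}$ is called extremal if its minimum distance equals $4\lfloor n/24\rfloor+4$. For $n=24m+8l$ with $l\in\{1,2\}$, a singly-even self-dual code of length $n$ is said to have minimal shadow if $\mathrm{wt}(S)=4$. -}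

module Defs where

open import Data.Bool using (Bool; true; false; _xor_; _∧_)
open import Data.Nat using (ℕ; zero; suc; _+_; _*_; _≤_)
open import Data.Nat.DivMod using (_/_; _%_)
open import Data.Nat.Divisibility using (_∣_)
open import Data.Vec using (Vec; []; _∷_; replicate; zipWith; foldr)
open import Data.Product using (Σ; _×_; _,_; ∃)
open import Data.Sum using (_⊎_)
open import Relation.Nullary using (¬_)
open import Relation.Binary.PropositionalEquality using (_≡_; _≢_)
open import Function.Bundles using (_⇔_)

-- Binary words of length n (vectors over F₂ = Bool with xor as addition).
Word : ℕ → Set
Word n = Vec Bool n

zeroWord : ∀ {n} → Word n
zeroWord = replicate _ false

_⊕_ : ∀ {n} → Word n → Word n → Word n
u ⊕ v = zipWith _xor_ u v

dot : ∀ {n} → Word n → Word n → Bool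
dot u v = foldr (λ _ → Bool) _xor_ false (zipWith _∧_ u v)

wt : ∀ {n} → Word n → ℕ
wt [] = 0
wt (true ∷ v) = suc (wt v)
wt (false ∷ v) = wt v

WordSet : ℕ → Set₁
WordSet n = Word n → Set

-- Binary linear code: subset containing 0 and closed under addition
-- (over F₂ this is exactly an F₂-subspace).
record IsLinearCode {n : ℕ} (C : WordSet n) : Set where
  field
    has-zero : C zeroWord
    closed-⊕ : ∀ u v → C u → C v → C (u ⊕ v)

Dual : ∀ {n} → WordSet n → WordSet n
Dual C v = ∀ c → C c → dot v c ≡ false

record IsSelfDual {n : ℕ} (C : WordSet n) : Set where
  field
    linear : IsLinearCode C
    self-dual : ∀ v → C v ⇔ Dual C v

DoublyEven : ∀ {n} → WordSet n → Set
DoublyEven C = ∀ c → C c → 4 ∣ wt c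

SinglyEven : ∀ {n} → WordSet n → Set
SinglyEven C = (∀ c → C c → 2 ∣ wt c) × ∃ λ c → C c × wt c % 4 ≡ 2

-- Minimum distance of a (linear) code: minimum weight of a nonzero codeword.
MinDist : ∀ {n} → WordSet n → ℕ → Set
MinDist C d = (∃ λ c → C c × c ≢ zeroWord × wt c ≡ d)
            × (∀ c → C c → c ≢ zeroWord → d ≤ wt c)

Extremal : ∀ {n} → WordSet n → Set
Extremal {n} C = MinDist C (4 * (n / 24) + 4)

DoublyEvenSubcode : ∀ {n} → WordSet n → WordSet n
DoublyEvenSubcode C c = C c × 4 ∣ wt c

Shadow : ∀ {n} → WordSet n → WordSet n
Shadow C v = Dual (DoublyEvenSubcode C) v × ¬ C v

MinWeight : ∀ {n} → WordSet n → ℕ → Set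
MinWeight S w = (∃ λ s → S s × wt s ≡ w) × (∀ s → S s → w ≤ wt s)

MinimalShadow : ∀ {n} → WordSet n → Set
MinimalShadow C = MinWeight (Shadow C) 4

module Submission where

-- From an extremal singly-even self-dual code with minimal shadow we build an
-- extremal doubly-even self-dual code of the same length, so the non-existence
-- of the latter rules out the former.
--
-- Let C be singly-even self-dual, C₀ its doubly-even subcode and s a shadow
-- vector of weight 4.  Two facts drive the construction.
--   * Shadow law: every c ∈ C satisfies wt c ≡ 2 (s·c) (mod 4), i.e. s is
--     orthogonal to C₀ and meets every codeword of weight ≡ 2 (mod 4).
--   * Since s·s = 0, the transvection τ v = v + (s·v) s is a linear,
--     involutive isometry of F₂ⁿ, so D = τ⁻¹(C) = C₀ ∪ (C₂ + s) is again
--     self-dual.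
-- By the shadow law every word of D has weight ≡ 0 (mod 4); a weight count
-- modulo 4 (using wt(v + s) ≤ wt v + 4) shows that D keeps the minimum
-- distance d = 4⌊n/24⌋ + 4 of C.

open import Defs
open import Data.Nat using (ℕ; _+_; _*_)
open import Data.Product using (Σ; _×_; ∃)
open import Data.Sum using (_⊎_)
open import Relation.Nullary using (¬_)
open import Relation.Binary.PropositionalEquality using (_≡_)

open import Algebra.Bundles using (CommutativeRing)
import Algebra.Properties.CommutativeSemigroup as CommutativeSemigroupProperties
open import Data.Bool using (Bool; true; false; not; _xor_; _∧_; if_then_else_)
open import Data.Bool.Properties
  using (∧-comm; ∧-zeroʳ; ∧-distribʳ-xor; xor-assoc; xor-comm; xor-same;
         xor-identityˡ; xor-identityʳ; xor-∧-commutativeRing)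
open import Data.Empty using (⊥-elim)
open import Data.Nat using (zero; suc; _≤_; z≤n; s≤s; s≤s⁻¹; _/_; _%_)
open import Data.Nat.DivMod using ([m+n]%n≡m%n)
open import Data.Nat.Divisibility using (_∣_; divides; m∣m*n; ∣-refl; ∣m∣n⇒∣m+n)
open import Data.Nat.Properties
  using (≤-trans; ≤-reflexive; m≤n⇒m≤1+n; n≤1+n; +-comm; +-suc; +-monoʳ-≤)
open import Data.Product using (_,_; proj₁; proj₂)
open import Data.Sum using (inj₁; inj₂)
open import Data.Vec using ([]; _∷_)
open import Data.Vec.Properties using (zipWith-assoc; zipWith-comm; zipWith-identityˡ; zipWith-identityʳ)
open import Function.Bundles using (Equivalence; mk⇔)
open import Relation.Binary.PropositionalEquality
  using (_≢_; refl; sym; trans; cong; cong₂; subst; module ≡-Reasoning)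

open CommutativeSemigroupProperties (CommutativeRing.+-commutativeSemigroup xor-∧-commutativeRing)
  using () renaming (interchange to xor-interchange)

-- The additive group ℤ/4, in which weights modulo 4 are computed

data Z4 : Set where
  z0 z1 z2 z3 : Z4

inc : Z4 → Z4
inc z0 = z1
inc z1 = z2
inc z2 = z3
inc z3 = z0

dec : Z4 → Z4
dec z0 = z3
dec z1 = z0
dec z2 = z1
dec z3 = z2

infixl 6 _+₄_
_+₄_ : Z4 → Z4 → Z4
z0 +₄ y = y
z1 +₄ y = inc y
z2 +₄ y = inc (inc y)
z3 +₄ y = inc (inc (inc y))

dbl : Bool → Z4
dbl false = z0
dbl true = z2

par : Z4 → Bool
par z0 = false
par z1 = true
par z2 = false
par z3 = true

inc⁴ : ∀ x → inc (inc (inc (inc x))) ≡ x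
inc⁴ z0 = refl
inc⁴ z1 = refl
inc⁴ z2 = refl
inc⁴ z3 = refl

dec-inc : ∀ x → dec (inc x) ≡ x
dec-inc z0 = refl
dec-inc z1 = refl
dec-inc z2 = refl
dec-inc z3 = refl

inc-injective : ∀ {x y} → inc x ≡ inc y → x ≡ y
inc-injective {x} {y} eq = trans (sym (dec-inc x)) (trans (cong dec eq) (dec-inc y))

inc-+₄ : ∀ x y → inc x +₄ y ≡ inc (x +₄ y)
inc-+₄ z0 y = refl
inc-+₄ z1 y = refl
inc-+₄ z2 y = refl
inc-+₄ z3 y = sym (inc⁴ y)

+₄-inc : ∀ x y → x +₄ inc y ≡ inc (x +₄ y)
+₄-inc z0 y = refl
+₄-inc z1 y = refl
+₄-inc z2 y = refl
+₄-inc z3 y = refl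

dbl-not : ∀ b → dbl (not b) ≡ inc (inc (dbl b))
dbl-not false = refl
dbl-not true = refl

dbl≡z0 : ∀ {b} → dbl b ≡ z0 → b ≡ false
dbl≡z0 {false} _ = refl
dbl≡z0 {true} ()

par-inc : ∀ x → par (inc x) ≡ not (par x)
par-inc z0 = refl
par-inc z1 = refl
par-inc z2 = refl
par-inc z3 = refl

even-residue : ∀ x → par x ≡ false → x ≡ z0 ⊎ x ≡ z2
even-residue z0 _ = inj₁ refl
even-residue z2 _ = inj₂ refl
even-residue z1 ()
even-residue z3 ()

shift-left : ∀ x y e → inc x +₄ y +₄ e ≡ inc (x +₄ y +₄ e)
shift-left x y e = trans (cong (_+₄ e) (inc-+₄ x y)) (inc-+₄ (x +₄ y) e)

shift-right : ∀ x y e → x +₄ inc y +₄ e ≡ inc (x +₄ y +₄ e)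
shift-right x y e = trans (cong (_+₄ e) (+₄-inc x y)) (inc-+₄ (x +₄ y) e)

shift-both : ∀ x y b → inc x +₄ inc y +₄ dbl (not b) ≡ x +₄ y +₄ dbl b
shift-both x y b = begin
  inc x +₄ inc y +₄ dbl (not b)      ≡⟨ shift-left x (inc y) (dbl (not b)) ⟩
  inc (x +₄ inc y +₄ dbl (not b))    ≡⟨ cong inc (shift-right x y (dbl (not b))) ⟩
  inc (inc (x +₄ y +₄ dbl (not b)))
    ≡⟨ cong (λ e → inc (inc (x +₄ y +₄ e))) (dbl-not b) ⟩
  inc (inc (x +₄ y +₄ inc (inc (dbl b))))
    ≡⟨ cong (λ r → inc (inc r)) (trans (+₄-inc (x +₄ y) _) (cong inc (+₄-inc (x +₄ y) _))) ⟩
  inc (inc (inc (inc (x +₄ y +₄ dbl b))))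
    ≡⟨ inc⁴ _ ⟩
  x +₄ y +₄ dbl b ∎
  where open ≡-Reasoning

res4 : ℕ → Z4
res4 zero = z0
res4 (suc x) = inc (res4 x)

res4-*4 : ∀ k → res4 (k * 4) ≡ z0
res4-*4 zero = refl
res4-*4 (suc k) = cong (λ r → inc (inc (inc (inc r)))) (res4-*4 k)

res4-∣ : ∀ {x} → 4 ∣ x → res4 x ≡ z0
res4-∣ (divides k refl) = res4-*4 k

∣-res4 : ∀ x → res4 x ≡ z0 → 4 ∣ x
∣-res4 zero _ = divides 0 refl
∣-res4 (suc (suc (suc (suc x)))) eq with ∣-res4 x (trans (sym (inc⁴ (res4 x))) eq)
... | divides k x≡k*4 = divides (suc k) (cong (λ y → suc (suc (suc (suc y)))) x≡k*4)

res4-% : ∀ x → res4 x ≡ res4 (x % 4)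
res4-% zero = refl
res4-% (suc zero) = refl
res4-% (suc (suc zero)) = refl
res4-% (suc (suc (suc zero))) = refl
res4-% (suc (suc (suc (suc x)))) = begin
  inc (inc (inc (inc (res4 x)))) ≡⟨ inc⁴ (res4 x) ⟩
  res4 x                         ≡⟨ res4-% x ⟩
  res4 (x % 4)                   ≡⟨ cong res4 (sym (trans (cong (_% 4) (+-comm 4 x)) ([m+n]%n≡m%n x 4))) ⟩
  res4 ((4 + x) % 4)             ∎
  where open ≡-Reasoning

congruent-≤ : ∀ x y → res4 x ≡ res4 y → x ≤ 3 + y → x ≤ y
congruent-≤ zero y _ _ = z≤n
congruent-≤ (suc x) (suc y) eq (s≤s x≤3+y) = s≤s (congruent-≤ x y (inc-injective eq) x≤3+y)
congruent-≤ (suc zero) zero () _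
congruent-≤ (suc (suc zero)) zero () _
congruent-≤ (suc (suc (suc zero))) zero () _
congruent-≤ (suc (suc (suc (suc x)))) zero _ (s≤s (s≤s (s≤s ())))

skip-residue-2 : ∀ d w v → res4 d ≡ z0 → res4 w ≡ z2 → res4 v ≡ z0
               → d ≤ w → w ≤ v + 4 → d ≤ v
skip-residue-2 d w v d≡0 w≡2 v≡0 d≤w w≤v+4 = congruent-≤ d v (trans d≡0 (sym v≡0)) d≤3+v
  where
  2+d≤w : 2 + d ≤ w
  2+d≤w = congruent-≤ (2 + d) w (trans (cong (λ r → inc (inc r)) d≡0) (sym w≡2))
                      (s≤s (s≤s (m≤n⇒m≤1+n d≤w)))
  d≤3+v : d ≤ 3 + v
  d≤3+v = m≤n⇒m≤1+n (s≤s⁻¹ (s≤s⁻¹ (≤-trans 2+d≤w (≤-trans w≤v+4 (≤-reflexive (+-comm v 4))))))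

⊕-assoc : ∀ {n} (u v w : Word n) → (u ⊕ v) ⊕ w ≡ u ⊕ (v ⊕ w)
⊕-assoc = zipWith-assoc xor-assoc

⊕-comm : ∀ {n} (u v : Word n) → u ⊕ v ≡ v ⊕ u
⊕-comm = zipWith-comm xor-comm

⊕-identityˡ : ∀ {n} (u : Word n) → zeroWord ⊕ u ≡ u
⊕-identityˡ = zipWith-identityˡ xor-identityˡ

⊕-identityʳ : ∀ {n} (u : Word n) → u ⊕ zeroWord ≡ u
⊕-identityʳ = zipWith-identityʳ xor-identityʳ

⊕-self : ∀ {n} (u : Word n) → u ⊕ u ≡ zeroWord
⊕-self [] = refl
⊕-self (a ∷ u) = cong₂ _∷_ (xor-same a) (⊕-self u)

⊕-cancelʳ : ∀ {n} (u v : Word n) → (u ⊕ v) ⊕ v ≡ u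
⊕-cancelʳ u v = trans (⊕-assoc u v v) (trans (cong (u ⊕_) (⊕-self v)) (⊕-identityʳ u))

⊕-interchange : ∀ {n} (u v w x : Word n) → (u ⊕ v) ⊕ (w ⊕ x) ≡ (u ⊕ w) ⊕ (v ⊕ x)
⊕-interchange [] [] [] [] = refl
⊕-interchange (a ∷ u) (b ∷ v) (c ∷ w) (d ∷ x) =
  cong₂ _∷_ (xor-interchange a b c d) (⊕-interchange u v w x)

dot-sym : ∀ {n} (u v : Word n) → dot u v ≡ dot v u
dot-sym [] [] = refl
dot-sym (a ∷ u) (b ∷ v) = cong₂ _xor_ (∧-comm a b) (dot-sym u v)

dot-zeroˡ : ∀ {n} (w : Word n) → dot zeroWord w ≡ false
dot-zeroˡ [] = refl
dot-zeroˡ (a ∷ w) = dot-zeroˡ w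

dot-⊕ˡ : ∀ {n} (u v w : Word n) → dot (u ⊕ v) w ≡ dot u w xor dot v w
dot-⊕ˡ [] [] [] = refl
dot-⊕ˡ (a ∷ u) (b ∷ v) (c ∷ w) = trans
  (cong₂ _xor_ (∧-distribʳ-xor c a b) (dot-⊕ˡ u v w))
  (xor-interchange (a ∧ c) (b ∧ c) (dot u w) (dot v w))

dot-⊕ʳ : ∀ {n} (w u v : Word n) → dot w (u ⊕ v) ≡ dot w u xor dot w v
dot-⊕ʳ w u v = trans (dot-sym w (u ⊕ v))
  (trans (dot-⊕ˡ u v w) (cong₂ _xor_ (dot-sym u w) (dot-sym v w)))

infix 25 _·_
_·_ : ∀ {n} → Bool → Word n → Word n
b · s = if b then s else zeroWord

·-xor : ∀ {n} a b (s : Word n) → (a xor b) · s ≡ a · s ⊕ b · s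
·-xor false false s = sym (⊕-identityʳ zeroWord)
·-xor false true s = sym (⊕-identityˡ s)
·-xor true false s = sym (⊕-identityʳ s)
·-xor true true s = sym (⊕-self s)

dot-·ʳ : ∀ {n} (w : Word n) b s → dot w (b · s) ≡ b ∧ dot w s
dot-·ʳ w false s = trans (dot-sym w zeroWord) (dot-zeroˡ w)
dot-·ʳ w true s = refl

wt₄ : ∀ {n} → Word n → Z4
wt₄ v = res4 (wt v)

wt₄-⊕ : ∀ {n} (u v : Word n) → wt₄ (u ⊕ v) ≡ wt₄ u +₄ wt₄ v +₄ dbl (dot u v)
wt₄-⊕ [] [] = refl
wt₄-⊕ (true ∷ u) (true ∷ v) = trans (wt₄-⊕ u v) (sym (shift-both (wt₄ u) (wt₄ v) (dot u v)))
wt₄-⊕ (true ∷ u) (false ∷ v) = trans (cong inc (wt₄-⊕ u v)) (sym (shift-left (wt₄ u) (wt₄ v) _))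
wt₄-⊕ (false ∷ u) (true ∷ v) = trans (cong inc (wt₄-⊕ u v)) (sym (shift-right (wt₄ u) (wt₄ v) _))
wt₄-⊕ (false ∷ u) (false ∷ v) = wt₄-⊕ u v

par-wt₄ : ∀ {n} (v : Word n) → par (wt₄ v) ≡ dot v v
par-wt₄ [] = refl
par-wt₄ (true ∷ v) = trans (par-inc (wt₄ v)) (cong not (par-wt₄ v))
par-wt₄ (false ∷ v) = par-wt₄ v

wt₄-zero : ∀ {n} → wt₄ (zeroWord {n}) ≡ z0
wt₄-zero {zero} = refl
wt₄-zero {suc n} = wt₄-zero {n}

class-2-nonzero : ∀ {n} (v : Word n) → wt₄ v ≡ z2 → v ≢ zeroWord
class-2-nonzero {n} v v≡2 refl with trans (sym (wt₄-zero {n})) v≡2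
... | ()

wt-⊕-≤ : ∀ {n} (u v : Word n) → wt (u ⊕ v) ≤ wt u + wt v
wt-⊕-≤ [] [] = z≤n
wt-⊕-≤ (true ∷ u) (true ∷ v) =
  ≤-trans (wt-⊕-≤ u v) (≤-trans (+-monoʳ-≤ (wt u) (n≤1+n (wt v))) (n≤1+n _))
wt-⊕-≤ (true ∷ u) (false ∷ v) = s≤s (wt-⊕-≤ u v)
wt-⊕-≤ (false ∷ u) (true ∷ v) = ≤-trans (s≤s (wt-⊕-≤ u v)) (≤-reflexive (sym (+-suc (wt u) (wt v))))
wt-⊕-≤ (false ∷ u) (false ∷ v) = wt-⊕-≤ u v

selfOrthogonal-residue : ∀ {n} (c : Word n) → dot c c ≡ false → wt₄ c ≡ z0 ⊎ wt₄ c ≡ z2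
selfOrthogonal-residue c c·c≡0 = even-residue (wt₄ c) (trans (par-wt₄ c) c·c≡0)

xor≡false⇒≡ : ∀ {a b} → a xor b ≡ false → a ≡ b
xor≡false⇒≡ {false} {false} _ = refl
xor≡false⇒≡ {true} {true} _ = refl
xor≡false⇒≡ {false} {true} ()
xor≡false⇒≡ {true} {false} ()

module Transvection {n} (s : Word n) (s-isotropic : dot s s ≡ false) where

  τ : Word n → Word n
  τ v = v ⊕ dot s v · s

  τ-fix : ∀ {v} → dot s v ≡ false → τ v ≡ v
  τ-fix {v} s·v≡0 = trans (cong (λ b → v ⊕ b · s) s·v≡0) (⊕-identityʳ v)

  τ-move : ∀ {v} → dot s v ≡ true → τ v ≡ v ⊕ s
  τ-move {v} s·v≡1 = cong (λ b → v ⊕ b · s) s·v≡1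

  τ-dot : ∀ v → dot s (τ v) ≡ dot s v
  τ-dot v = begin
    dot s (v ⊕ b · s)        ≡⟨ dot-⊕ʳ s v (b · s) ⟩
    b xor dot s (b · s)      ≡⟨ cong (b xor_) (dot-·ʳ s b s) ⟩
    b xor (b ∧ dot s s)      ≡⟨ cong (λ e → b xor (b ∧ e)) s-isotropic ⟩
    b xor (b ∧ false)        ≡⟨ cong (b xor_) (∧-zeroʳ b) ⟩
    b xor false              ≡⟨ xor-identityʳ b ⟩
    b                        ∎
    where
    open ≡-Reasoning
    b = dot s v

  τ-involutive : ∀ v → τ (τ v) ≡ v
  τ-involutive v = trans (cong (λ b → τ v ⊕ b · s) (τ-dot v)) (⊕-cancelʳ v (dot s v · s))

  τ-⊕ : ∀ u v → τ (u ⊕ v) ≡ τ u ⊕ τ v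
  τ-⊕ u v = begin
    (u ⊕ v) ⊕ dot s (u ⊕ v) · s        ≡⟨ cong (λ b → (u ⊕ v) ⊕ b · s) (dot-⊕ʳ s u v) ⟩
    (u ⊕ v) ⊕ (dot s u xor dot s v) · s ≡⟨ cong ((u ⊕ v) ⊕_) (·-xor (dot s u) (dot s v) s) ⟩
    (u ⊕ v) ⊕ (dot s u · s ⊕ dot s v · s) ≡⟨ ⊕-interchange u v _ _ ⟩
    τ u ⊕ τ v ∎
    where open ≡-Reasoning

  τ-isometry : ∀ u v → dot (τ u) (τ v) ≡ dot u v
  τ-isometry u v = begin
    dot (u ⊕ a · s) (τ v)                     ≡⟨ dot-⊕ˡ u (a · s) (τ v) ⟩
    dot u (τ v) xor dot (a · s) (τ v)         ≡⟨ cong₂ _xor_ dot-u-τv dot-as-τv ⟩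
    (dot u v xor (b ∧ a)) xor (a ∧ b)         ≡⟨ xor-assoc (dot u v) (b ∧ a) (a ∧ b) ⟩
    dot u v xor ((b ∧ a) xor (a ∧ b))         ≡⟨ cong (λ e → dot u v xor (e xor (a ∧ b))) (∧-comm b a) ⟩
    dot u v xor ((a ∧ b) xor (a ∧ b))         ≡⟨ cong (dot u v xor_) (xor-same (a ∧ b)) ⟩
    dot u v xor false                         ≡⟨ xor-identityʳ (dot u v) ⟩
    dot u v                                   ∎
    where
    open ≡-Reasoning
    a = dot s u
    b = dot s v
    dot-u-τv : dot u (τ v) ≡ dot u v xor (b ∧ a)
    dot-u-τv = trans (dot-⊕ʳ u v (b · s))
      (cong (dot u v xor_) (trans (dot-·ʳ u b s) (cong (b ∧_) (dot-sym u s))))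
    dot-as-τv : dot (a · s) (τ v) ≡ a ∧ b
    dot-as-τv = trans (dot-sym (a · s) (τ v))
      (trans (dot-·ʳ (τ v) a s) (cong (a ∧_) (trans (dot-sym (τ v) s) (τ-dot v))))

preimage-selfDual : ∀ {n} {C : WordSet n} (f : Word n → Word n)
  → (∀ u v → f (u ⊕ v) ≡ f u ⊕ f v)
  → (∀ v → f (f v) ≡ v)
  → (∀ u v → dot (f u) (f v) ≡ dot u v)
  → IsSelfDual C → IsSelfDual (λ v → C (f v))
preimage-selfDual {n} {C} f f-⊕ f-involutive f-isometry sd = record
  { linear = record
    { has-zero = subst C (sym f-zero) has-zero
    ; closed-⊕ = λ u v fu∈C fv∈C → subst C (sym (f-⊕ u v)) (closed-⊕ (f u) (f v) fu∈C fv∈C)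
    }
  ; self-dual = λ v → mk⇔ (to-dual v) (from-dual v)
  }
  where
  open IsSelfDual sd
  open IsLinearCode linear

  f-zero : f zeroWord ≡ zeroWord
  f-zero = begin
    f zeroWord               ≡⟨ cong f (sym (⊕-self zeroWord)) ⟩
    f (zeroWord ⊕ zeroWord)  ≡⟨ f-⊕ zeroWord zeroWord ⟩
    f zeroWord ⊕ f zeroWord  ≡⟨ ⊕-self (f zeroWord) ⟩
    zeroWord                 ∎
    where open ≡-Reasoning

  to-dual : ∀ v → C (f v) → Dual (λ w → C (f w)) v
  to-dual v fv∈C w fw∈C = trans (sym (f-isometry v w)) (Equivalence.to (self-dual (f v)) fv∈C (f w) fw∈C)

  -- a codeword c is the image f (f c) of the preimage word f c
  from-dual : ∀ v → Dual (λ w → C (f w)) v → C (f v)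
  from-dual v v⊥ = Equivalence.from (self-dual (f v)) λ c c∈C → begin
    dot (f v) c          ≡⟨ cong (dot (f v)) (sym (f-involutive c)) ⟩
    dot (f v) (f (f c))  ≡⟨ f-isometry v (f c) ⟩
    dot v (f c)          ≡⟨ v⊥ (f c) (subst C (sym (f-involutive c)) c∈C) ⟩
    false                ∎
    where open ≡-Reasoning

module ShadowLaw {n} {C : WordSet n} (sd : IsSelfDual C)
                 {c₂ : Word n} (c₂∈C : C c₂) (c₂-residue : wt₄ c₂ ≡ z2)
                 {s : Word n} (s∈S : Shadow C s) where
  open IsSelfDual sd
  open IsLinearCode linear

  codeword-residue : ∀ {c} → C c → wt₄ c ≡ z0 ⊎ wt₄ c ≡ z2
  codeword-residue {c} c∈C = selfOrthogonal-residue c (Equivalence.to (self-dual c) c∈C c c∈C)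

  s⊥C₀ : ∀ {c} → C c → wt₄ c ≡ z0 → dot s c ≡ false
  s⊥C₀ {c} c∈C c≡0 = proj₁ s∈S c (c∈C , ∣-res4 (wt c) c≡0)

  -- a codeword of weight ≡ 2 lies in the coset C₀ + c₂, so s pairs with it as with c₂
  s-on-C₂ : ∀ {c} → C c → wt₄ c ≡ z2 → dot s c ≡ dot s c₂
  s-on-C₂ {c} c∈C c≡2 =
    xor≡false⇒≡ (trans (sym (dot-⊕ʳ s c c₂)) (s⊥C₀ (closed-⊕ c c₂ c∈C c₂∈C) sum≡0))
    where
    sum≡0 : wt₄ (c ⊕ c₂) ≡ z0
    sum≡0 = begin
      wt₄ (c ⊕ c₂)                       ≡⟨ wt₄-⊕ c c₂ ⟩
      wt₄ c +₄ wt₄ c₂ +₄ dbl (dot c c₂)  ≡⟨ cong₂ (λ x y → x +₄ y +₄ dbl (dot c c₂)) c≡2 c₂-residue ⟩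
      z2 +₄ z2 +₄ dbl (dot c c₂)         ≡⟨ cong (λ b → z2 +₄ z2 +₄ dbl b) (Equivalence.to (self-dual c) c∈C c₂ c₂∈C) ⟩
      z0                                 ∎
      where open ≡-Reasoning

  -- s ∉ C = C^⊥, which forces s·c₂ = 1
  s-meets-c₂ : dot s c₂ ≡ true
  s-meets-c₂ with dot s c₂ in s·c₂
  ... | true = refl
  ... | false = ⊥-elim (proj₂ s∈S (Equivalence.from (self-dual s) s⊥C))
    where
    s⊥C : Dual C s
    s⊥C c c∈C with codeword-residue c∈C
    ... | inj₁ c≡0 = s⊥C₀ c∈C c≡0
    ... | inj₂ c≡2 = trans (s-on-C₂ c∈C c≡2) s·c₂

  shadow-law : ∀ {c} → C c → wt₄ c ≡ dbl (dot s c)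
  shadow-law c∈C with codeword-residue c∈C
  ... | inj₁ c≡0 = trans c≡0 (cong dbl (sym (s⊥C₀ c∈C c≡0)))
  ... | inj₂ c≡2 = trans c≡2 (cong dbl (sym (trans (s-on-C₂ c∈C c≡2) s-meets-c₂)))

module Neighbour {n} {C : WordSet n} (sd : IsSelfDual C)
                 {s : Word n} (s-residue : wt₄ s ≡ z0)
                 (shadow-law : ∀ {c} → C c → wt₄ c ≡ dbl (dot s c)) where

  s-isotropic : dot s s ≡ false
  s-isotropic = trans (sym (par-wt₄ s)) (cong par s-residue)

  open Transvection s s-isotropic

  D : WordSet n
  D v = C (τ v)

  D-selfDual : IsSelfDual D
  D-selfDual = preimage-selfDual τ τ-⊕ τ-involutive τ-isometry sd

  -- wt (τ c) ≡ wt c + 2 (s·c) ≡ 0 (mod 4)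
  τ-residue : ∀ {c} → C c → wt₄ (τ c) ≡ z0
  τ-residue {c} c∈C = by-bit (dot s c) refl
    where
    by-bit : ∀ b → dot s c ≡ b → wt₄ (τ c) ≡ z0
    by-bit false s·c = trans (cong wt₄ (τ-fix s·c)) (trans (shadow-law c∈C) (cong dbl s·c))
    by-bit true s·c = begin
      wt₄ (τ c)                        ≡⟨ cong wt₄ (τ-move s·c) ⟩
      wt₄ (c ⊕ s)                      ≡⟨ wt₄-⊕ c s ⟩
      wt₄ c +₄ wt₄ s +₄ dbl (dot c s)  ≡⟨ cong₂ (λ x y → x +₄ y +₄ dbl (dot c s))
                                                (trans (shadow-law c∈C) (cong dbl s·c)) s-residue ⟩
      z2 +₄ z0 +₄ dbl (dot c s)        ≡⟨ cong (λ b → z2 +₄ z0 +₄ dbl b) (trans (dot-sym c s) s·c) ⟩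
      z0                               ∎
      where open ≡-Reasoning

  D-doublyEven : DoublyEven D
  D-doublyEven v τv∈C = ∣-res4 (wt v) (trans (cong wt₄ (sym (τ-involutive v))) (τ-residue τv∈C))

  -- A minimum-weight word of C has weight ≡ 0, so it lies in C₀ ⊆ D; a word
  -- v ∈ D outside C has τ v = v + s ∈ C₂, whence d ≤ wt (v + s) ≤ wt v + 4
  -- and the residues force d ≤ wt v.
  D-minDist : ∀ {d} → res4 d ≡ z0 → wt s ≡ 4 → MinDist C d → MinDist D d
  D-minDist {d} d≡0 wt-s ((c , c∈C , c≢0 , wt-c) , C-bound) = (c , c∈D , c≢0 , wt-c) , D-bound
    where
    c∈D : D c
    c∈D = subst C (sym (τ-fix (dbl≡z0 (trans (sym (shadow-law c∈C)) (trans (cong res4 wt-c) d≡0))))) c∈C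

    D-bound : ∀ v → D v → v ≢ zeroWord → d ≤ wt v
    D-bound v τv∈C v≢0 = by-bit (dot s v) refl
      where
      by-bit : ∀ b → dot s v ≡ b → d ≤ wt v
      by-bit false s·v = C-bound v (subst C (τ-fix s·v) τv∈C) v≢0
      by-bit true s·v = skip-residue-2 d (wt (τ v)) (wt v) d≡0 τv≡2 (res4-∣ (D-doublyEven v τv∈C))
                          (C-bound (τ v) τv∈C (class-2-nonzero (τ v) τv≡2)) wt-τv≤
        where
        τv≡2 : wt₄ (τ v) ≡ z2
        τv≡2 = trans (shadow-law τv∈C) (cong dbl (trans (τ-dot v) s·v))
        wt-τv≤ : wt (τ v) ≤ wt v + 4
        wt-τv≤ = subst (λ w → wt w ≤ wt v + 4) (sym (τ-move s·v))
                   (subst (λ k → wt (v ⊕ s) ≤ wt v + k) wt-s (wt-⊕-≤ v s))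

proposition5 : (m n : ℕ) → (n ≡ 24 * m + 8 ⊎ n ≡ 24 * m + 16)
    → ¬ (Σ (WordSet n) λ C → IsSelfDual C × DoublyEven C × Extremal C)
    → ¬ (Σ (WordSet n) λ C → IsSelfDual C × SinglyEven C × Extremal C × MinimalShadow C)
proposition5 m n _ no-extremal-doublyEven
  (C , sd , (_ , c₂ , c₂∈C , wt-c₂%4) , C-extremal , (s , s∈S , wt-s) , _) =
  no-extremal-doublyEven (D , D-selfDual , D-doublyEven , D-minDist d≡0 wt-s C-extremal)
  where
  c₂-residue : wt₄ c₂ ≡ z2
  c₂-residue = trans (res4-% (wt c₂)) (cong res4 wt-c₂%4)

  open ShadowLaw sd c₂∈C c₂-residue s∈S using (shadow-law)
  open Neighbour sd {s} (cong res4 wt-s) shadow-law using (D; D-selfDual; D-doublyEven; D-minDist)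

  d≡0 : res4 (4 * (n / 24) + 4) ≡ z0
  d≡0 = res4-∣ (∣m∣n⇒∣m+n (m∣m*n (n / 24)) ∣-refl)
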